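{- Let $G$ be a modular graph and $(u,v)$ a pair of vertices with $d(u,v)=2$. If there exists a profile $\pi$ such that $F_\pi$ is not pseudopeakless on $(u,v)$, then $I(u,v)\setminus\{u,v\}$ contains at least three vertices.
   Context: Graphs are undirected, simple and connected; $d$ is the distance, $I(u,v)=\{w:d(u,w)+d(w,v)=d(u,v)\}$. $G$ is modular if for every three vertices $x,y,z$, $I(x,y)\cap I(y,z)\cap I(z,x)\neq\emptyset$. A profile is a finite sequence $\pi=(x_1,\dots,x_n)$ of vertices (repetitions allowed) and $F_\pi(w)=\sum_i d(w,x_i)$. For a pair $(u,v)$ with $d(u,v)=2$, $F_\pi$ is pseudopeakless on $(u,v)$ if there exists $w\in I(u,v)\setminus\{u,v\}$ with $F_\pi(w)\le\max\{F_\pi(u),F_\pi(v)\}$, where equality holds only if $F_\pi(u)=F_\pi(w)=F_\pi(v)$. -}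

module Defs where

open import Data.Nat using (ℕ; zero; suc; _+_; _≤_; _⊔_)
open import Data.List using (List; map)
open import Data.Nat.ListAction using (sum)
open import Data.Product using (Σ; _×_; ∃; ∃-syntax)
open import Relation.Binary.PropositionalEquality using (_≡_)
open import Relation.Nullary using (¬_)

-- The fields d-walk / d-min say that
-- d u v is exactly the length of a shortest u–v walk (so the graph is connected
-- and d is the usual graph metric; d is uniquely determined by the adjacency).
-- walks of a given length in an adjacency relation
data Walk {V : Set} (_~_ : V → V → Set) : V → V → ℕ → Set where
  here : ∀ {u} → Walk _~_ u u zero
  step : ∀ {u w v n} → u ~ w → Walk _~_ w v n → Walk _~_ u v (suc n)

record Graph : Set₁ where
  field
    V      : Set
    _~_    : V → V → Set
    ~-sym  : ∀ {u v} → u ~ v → v ~ u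
    ~-irr  : ∀ {u} → ¬ (u ~ u)

  field
    d      : V → V → ℕ
    d-walk : ∀ u v → Walk _~_ u v (d u v)
    d-min  : ∀ u v n → Walk _~_ u v n → d u v ≤ n

module _ (G : Graph) where
  open Graph G

  _∈I[_,_] : V → V → V → Set
  w ∈I[ u , v ] = d u w + d w v ≡ d u v

  IsModular : Set
  IsModular = ∀ x y z → ∃[ m ] (m ∈I[ x , y ] × m ∈I[ y , z ] × m ∈I[ z , x ])

  Profile : Set
  Profile = List V

  F : Profile → V → ℕ
  F π w = sum (map (d w) π)

  Pseudopeakless : Profile → V → V → Set
  Pseudopeakless π u v =
    ∃[ w ] ( w ∈I[ u , v ] × ¬ (w ≡ u) × ¬ (w ≡ v)
           × F π w ≤ F π u ⊔ F π v
           × (F π w ≡ F π u ⊔ F π v → (F π u ≡ F π w × F π w ≡ F π v)) )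

module Submission where

-- The inner vertices of I(u,v) are the common neighbours of u and v.  For two of
-- them, a and b, the median m of u, v, x gives d a x + d b x ≤ d u x + d v x
-- unless m is a common neighbour distinct from both a and b; summing over π, if
-- F a + F b ≤ F u + F v then a or b witnesses pseudopeaklessness.  So when F_π
-- is not pseudopeakless, any common neighbour w₁ yields w₂ ≠ w₁ (take a = b = w₁)
-- and then w₃ ∉ {w₁, w₂} (take a = w₁, b = w₂).

open import Defs
open import Data.Nat using (ℕ; suc; _+_; _≤_; _<_; _⊔_; _≟_; _<?_; z≤n)
open import Data.Nat.Properties
open import Algebra.Properties.CommutativeSemigroup +-commutativeSemigroup using (interchange)
open import Data.Product using (_×_; ∃-syntax; _,_)
open import Data.Sum using (_⊎_; inj₁; inj₂)
open import Data.List using ([]; _∷_)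
open import Relation.Binary.PropositionalEquality
  using (_≡_; _≢_; refl; sym; trans; cong; cong₂; subst)
open import Relation.Nullary using (¬_; yes; no; contradiction)

Dominated : ℕ → ℕ → ℕ → Set
Dominated a b x = x ≤ a ⊔ b × (x ≡ a ⊔ b → a ≡ x × x ≡ b)

<⊔⇒Dominated : ∀ {a b x} → x < a ⊔ b → Dominated a b x
<⊔⇒Dominated x< = <⇒≤ x< , λ x≡ → contradiction x≡ (<⇒≢ x<)

+-tight⇒≡ : ∀ {a b c} → a ≤ c → b ≤ c → c + c ≤ a + b → a ≡ c
+-tight⇒≡ a≤c b≤c tight = ≤-antisym a≤c (≮⇒≥ λ a<c → <⇒≱ (+-mono-<-≤ a<c b≤c) tight)

-- If neither p nor q lies below c = a ⊔ b, then p + q ≤ a + b ≤ c + c forces p = q = a = b = c.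
+-≤⇒Dominated : ∀ a b p q → p + q ≤ a + b → Dominated a b p ⊎ Dominated a b q
+-≤⇒Dominated a b p q p+q≤a+b with p <? a ⊔ b | q <? a ⊔ b
... | yes p< | _      = inj₁ (<⊔⇒Dominated p<)
... | no _   | yes q< = inj₂ (<⊔⇒Dominated q<)
... | no p≮  | no q≮  = inj₁ (≤-reflexive p≡c , λ _ → trans a≡c (sym p≡c) , trans p≡c (sym b≡c))
  where
  c = a ⊔ b
  c≤p = ≮⇒≥ p≮
  c≤q = ≮⇒≥ q≮
  c+c≤a+b : c + c ≤ a + b
  c+c≤a+b = ≤-trans (+-mono-≤ c≤p c≤q) p+q≤a+b
  a≡c : a ≡ c
  a≡c = +-tight⇒≡ (m≤m⊔n a b) (m≤n⊔m a b) c+c≤a+b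
  b≡c : b ≡ c
  b≡c = +-tight⇒≡ (m≤n⊔m a b) (m≤m⊔n a b) (≤-trans c+c≤a+b (≤-reflexive (+-comm a b)))
  p+c≤c+c : p + c ≤ c + c
  p+c≤c+c = ≤-trans (+-monoʳ-≤ p c≤q) (≤-trans p+q≤a+b (≤-reflexive (cong₂ _+_ a≡c b≡c)))
  p≡c : p ≡ c
  p≡c = ≤-antisym (+-cancelʳ-≤ c p c p+c≤c+c) c≤p

+≡2-cases : ∀ {x y} → x + y ≡ 2 → x ≡ 0 ⊎ (x ≡ 1 × y ≡ 1) ⊎ y ≡ 0
+≡2-cases {0}                 _  = inj₁ refl
+≡2-cases {1} {1}             _  = inj₂ (inj₁ (refl , refl))
+≡2-cases {2} {0}             _  = inj₂ (inj₂ refl)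
+≡2-cases {1} {0}             ()
+≡2-cases {1} {suc (suc _)}   ()
+≡2-cases {2} {suc _}         ()
+≡2-cases {suc (suc (suc _))} ()

module Metric (G : Graph) where
  open Graph G

  _++ʷ_ : ∀ {a b c m n} → Walk _~_ a b m → Walk _~_ b c n → Walk _~_ a c (m + n)
  here     ++ʷ q = q
  step e p ++ʷ q = step e (p ++ʷ q)

  snocʷ : ∀ {a b c n} → Walk _~_ a b n → b ~ c → Walk _~_ a c (suc n)
  snocʷ here       e′ = step e′ here
  snocʷ (step e p) e′ = step e (snocʷ p e′)

  reverseʷ : ∀ {a b n} → Walk _~_ a b n → Walk _~_ b a n
  reverseʷ here       = here
  reverseʷ (step e p) = snocʷ (reverseʷ p) (~-sym e)

  d-sym : ∀ a b → d a b ≡ d b a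
  d-sym a b = ≤-antisym (d-min a b _ (reverseʷ (d-walk b a)))
                        (d-min b a _ (reverseʷ (d-walk a b)))

  d-triangle : ∀ a b c → d a c ≤ d a b + d b c
  d-triangle a b c = d-min a c _ (d-walk a b ++ʷ d-walk b c)

  d-refl : ∀ a → d a a ≡ 0
  d-refl a = n≤0⇒n≡0 (d-min a a 0 here)

  d≡0⇒≡ : ∀ {a b} → d a b ≡ 0 → a ≡ b
  d≡0⇒≡ {a} {b} d≡0 = walk-0 (subst (Walk _~_ a b) d≡0 (d-walk a b))
    where
    walk-0 : Walk _~_ a b 0 → a ≡ b
    walk-0 here = refl

  d≡1⇒≤suc : ∀ {a p} x → d a p ≡ 1 → d a x ≤ suc (d p x)
  d≡1⇒≤suc {a} {p} x d-ap = subst (λ k → d a x ≤ k + d p x) d-ap (d-triangle a p x)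

  ∈I-reverse : ∀ {m a b} → _∈I[_,_] G m a b → _∈I[_,_] G m b a
  ∈I-reverse {m} {a} {b} m∈I =
    trans (trans (+-comm (d b m) (d m a)) (cong₂ _+_ (d-sym m a) (d-sym b m))) (trans m∈I (d-sym a b))

  swap-d : ∀ {a b n} → d a b ≡ n → d b a ≡ n
  swap-d {a} {b} d-ab = trans (d-sym b a) d-ab

  +-≤-near-endpoint : ∀ {a b p q} x → d a p ≡ 1 → d b p ≡ 1 → d q x ≡ 2 + d p x →
                      d a x + d b x ≤ d p x + d q x
  +-≤-near-endpoint {p = p} x d-ap d-bp d-qx =
    ≤-trans (+-mono-≤ (d≡1⇒≤suc x d-ap) (d≡1⇒≤suc x d-bp))
            (≤-reflexive (trans (sym (+-suc (d p x) (suc (d p x)))) (cong (d p x +_) (sym d-qx))))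

  +-≤-via-median : ∀ {a b m p q} x → d a x ≡ d m x → d b p ≡ 1 →
                   d p x ≡ suc (d m x) → d q x ≡ suc (d m x) → d a x + d b x ≤ d p x + d q x
  +-≤-via-median {b = b} {m} x d-ax d-bp d-px d-qx =
    ≤-trans (+-mono-≤ (≤-reflexive d-ax) (subst (λ k → d b x ≤ suc k) d-px (d≡1⇒≤suc x d-bp)))
            (≤-reflexive (trans (+-suc (d m x) (suc (d m x))) (sym (cong₂ _+_ d-px d-qx))))

  Midpoint : V → V → V → Set
  Midpoint u v w = d u w ≡ 1 × d w v ≡ 1

  Separated : V → V → V → V → Set
  Separated u v a b = ∃[ m ] (Midpoint u v m × a ≢ m × b ≢ m)

  module DistanceTwo (u v : V) (d-uv : d u v ≡ 2) where

    Midpoint⇒interior : ∀ {w} → Midpoint u v w → _∈I[_,_] G w u v × w ≢ u × w ≢ v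
    Midpoint⇒interior (d-uw , d-wv) =
        trans (cong₂ _+_ d-uw d-wv) (sym d-uv)
      , (λ { refl → 0≢1+n (trans (sym (d-refl u)) d-uw) })
      , (λ { refl → 0≢1+n (trans (sym (d-refl v)) d-wv) })

    Dominated-midpoint⇒Pseudopeakless : ∀ {w} (π : Profile G) → Midpoint u v w →
                                        Dominated (F G π u) (F G π v) (F G π w) →
                                        Pseudopeakless G π u v
    Dominated-midpoint⇒Pseudopeakless π mw dom with Midpoint⇒interior mw
    ... | w∈I , w≢u , w≢v = _ , w∈I , w≢u , w≢v , dom

    ∈I⇒endpoint⊎Midpoint : ∀ {m} → _∈I[_,_] G m u v → u ≡ m ⊎ Midpoint u v m ⊎ m ≡ v
    ∈I⇒endpoint⊎Midpoint m∈I with +≡2-cases (trans m∈I d-uv)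
    ... | inj₁ d-um≡0        = inj₁ (d≡0⇒≡ d-um≡0)
    ... | inj₂ (inj₁ mid)    = inj₂ (inj₁ mid)
    ... | inj₂ (inj₂ d-mv≡0) = inj₂ (inj₂ (d≡0⇒≡ d-mv≡0))

    midpoint-exists : ∃[ w ] Midpoint u v w
    midpoint-exists = from-walk (subst (Walk _~_ u v) d-uv (d-walk u v))
      where
      from-walk : Walk _~_ u v 2 → ∃[ w ] Midpoint u v w
      from-walk (step {w = w} u~w (step w~v here)) with ∈I⇒endpoint⊎Midpoint {w} w∈I
        where
        w∈I : _∈I[_,_] G w u v
        w∈I = ≤-antisym
          (≤-trans (+-mono-≤ (d-min u w 1 (step u~w here)) (d-min w v 1 (step w~v here)))
                   (≤-reflexive (sym d-uv)))
          (d-triangle u w v)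
      ... | inj₁ refl        = contradiction u~w ~-irr
      ... | inj₂ (inj₁ mid)  = w , mid
      ... | inj₂ (inj₂ refl) = contradiction w~v ~-irr

    -- With m the median of u, v and x: when m is an endpoint, x is two steps
    -- farther from the other endpoint; when m is a midpoint, u and v are both
    -- one step farther from x than m is.
    bounded-or-separated-via : ∀ {a b m} x → Midpoint u v a → Midpoint u v b →
                               u ≡ m ⊎ Midpoint u v m ⊎ m ≡ v →
                               d u m + d m x ≡ d u x → d v m + d m x ≡ d v x →
                               d a x + d b x ≤ d u x + d v x ⊎ Separated u v a b
    bounded-or-separated-via x (d-ua , _) (d-ub , _) (inj₁ refl) _ d-vx =
      inj₁ (+-≤-near-endpoint x (swap-d d-ua) (swap-d d-ub)
              (trans (sym d-vx) (cong (_+ d u x) (swap-d d-uv))))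
    bounded-or-separated-via x (_ , d-av) (_ , d-bv) (inj₂ (inj₂ refl)) d-ux _ =
      inj₁ (≤-trans (+-≤-near-endpoint x d-av d-bv (trans (sym d-ux) (cong (_+ d v x) d-uv)))
                    (≤-reflexive (+-comm (d v x) (d u x))))
    bounded-or-separated-via {a} {b} {m} x (d-ua , _) (d-ub , _) (inj₂ (inj₁ (d-um , d-mv))) d-ux d-vx
      with d a x ≟ d m x | d b x ≟ d m x
    ... | yes a≡ | _      = inj₁ (+-≤-via-median x a≡ (swap-d d-ub) d-ux′ d-vx′)
      where
      d-ux′ = trans (sym d-ux) (cong (_+ d m x) d-um)
      d-vx′ = trans (sym d-vx) (cong (_+ d m x) (swap-d d-mv))
    ... | no _   | yes b≡ = inj₁ (≤-trans (≤-reflexive (+-comm (d a x) (d b x)))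
                                          (+-≤-via-median x b≡ (swap-d d-ua) d-ux′ d-vx′))
      where
      d-ux′ = trans (sym d-ux) (cong (_+ d m x) d-um)
      d-vx′ = trans (sym d-vx) (cong (_+ d m x) (swap-d d-mv))
    ... | no a≢  | no b≢  = inj₂ (m , (d-um , d-mv) , (λ { refl → a≢ refl }) , (λ { refl → b≢ refl }))

    module _ (modular : IsModular G) where

      bounded-or-separated-at : ∀ {a b} → Midpoint u v a → Midpoint u v b → ∀ x →
                                d a x + d b x ≤ d u x + d v x ⊎ Separated u v a b
      bounded-or-separated-at ma mb x with modular u v x
      ... | m , m∈Iuv , m∈Ivx , m∈Ixu =
        bounded-or-separated-via x ma mb (∈I⇒endpoint⊎Midpoint m∈Iuv) (∈I-reverse m∈Ixu) m∈Ivx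

      bounded-or-separated : ∀ {a b} → Midpoint u v a → Midpoint u v b → (π : Profile G) →
                             F G π a + F G π b ≤ F G π u + F G π v ⊎ Separated u v a b
      bounded-or-separated ma mb [] = inj₁ z≤n
      bounded-or-separated {a} {b} ma mb (x ∷ π)
        with bounded-or-separated-at ma mb x | bounded-or-separated ma mb π
      ... | inj₂ sep | _        = inj₂ sep
      ... | inj₁ _   | inj₂ sep = inj₂ sep
      ... | inj₁ ≤x  | inj₁ ≤π  = inj₁ (begin
        (d a x + F G π a) + (d b x + F G π b) ≡⟨ interchange (d a x) (F G π a) (d b x) (F G π b) ⟩
        (d a x + d b x) + (F G π a + F G π b) ≤⟨ +-mono-≤ ≤x ≤π ⟩
        (d u x + d v x) + (F G π u + F G π v) ≡⟨ interchange (d u x) (d v x) (F G π u) (F G π v) ⟩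
        (d u x + F G π u) + (d v x + F G π v) ∎)
        where open ≤-Reasoning

      separating-midpoint : ∀ {a b} (π : Profile G) → ¬ Pseudopeakless G π u v →
                            Midpoint u v a → Midpoint u v b → Separated u v a b
      separating-midpoint π not-ppl ma mb with bounded-or-separated ma mb π
      ... | inj₂ sep = sep
      ... | inj₁ ≤uv with +-≤⇒Dominated (F G π u) (F G π v) _ _ ≤uv
      ...   | inj₁ dom-a = contradiction (Dominated-midpoint⇒Pseudopeakless π ma dom-a) not-ppl
      ...   | inj₂ dom-b = contradiction (Dominated-midpoint⇒Pseudopeakless π mb dom-b) not-ppl

lemma14 : (G : Graph) → IsModular G → (u v : Graph.V G) → Graph.d G u v ≡ 2 →
    ∃[ π ] ¬ Pseudopeakless G π u v →
    ∃[ w₁ ] ∃[ w₂ ] ∃[ w₃ ]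
    ( (_∈I[_,_] G w₁ u v × ¬ (w₁ ≡ u) × ¬ (w₁ ≡ v))
    × (_∈I[_,_] G w₂ u v × ¬ (w₂ ≡ u) × ¬ (w₂ ≡ v))
    × (_∈I[_,_] G w₃ u v × ¬ (w₃ ≡ u) × ¬ (w₃ ≡ v))
    × ¬ (w₁ ≡ w₂) × ¬ (w₁ ≡ w₃) × ¬ (w₂ ≡ w₃) )
lemma14 G modular u v d-uv (π , not-ppl) =
  let w₁ , m₁                 = midpoint-exists
      w₂ , m₂ , w₁≢w₂ , _     = separate m₁ m₁
      w₃ , m₃ , w₁≢w₃ , w₂≢w₃ = separate m₁ m₂
  in  w₁ , w₂ , w₃
    , Midpoint⇒interior m₁ , Midpoint⇒interior m₂ , Midpoint⇒interior m₃
    , w₁≢w₂ , w₁≢w₃ , w₂≢w₃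
  where
  open Metric G
  open DistanceTwo u v d-uv
  separate : ∀ {a b} → Midpoint u v a → Midpoint u v b → Separated u v a b
  separate = separating-midpoint modular π not-ppl
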